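{- Let a conjunctive Boolean control network (CBCN) be given in which no state-variable that is not directly controlled has a constant update function. If the CBCN is controllable, then it has Property P: every simple node of its dependency graph has, among its in-neighbors, either a generator or a channel.
   Context: A CBCN with $n$ Boolean state-variables and control index set $\mathcal{I}\subseteq\{1,\dots,n\}$ evolves by $X_i(k+1)=U_i(k)$ for $i\in\mathcal{I}$ and $X_i(k+1)=\prod_{j=1}^n (X_j(k))^{\epsilon_{ji}}$ for $i\notin\mathcal{I}$, where $\epsilon_{ji}\in\{0,1\}$, products denote AND, $x^0=1$, and the $U_i(k)$ are independent Boolean controls; a state-variable $i\notin\mathcal{I}$ has a constant update function if $\epsilon_{ji}=0$ for all $j$. It is controllable if for every $a,b\in\{0,1\}^n$ there exist $N\ge 0$ and controls steering $X(0)=a$ to $X(N)=b$. Its dependency graph is the digraph with a vertex for each state-variable (a simple node) and a vertex for each control input $U_i$, $i\in\mathcal{I}$ (a generator), with an arc $j\to i$ whenever $i\notin\mathcal{I}$ and $\epsilon_{ji}=1$, and an arc $U_i\to i$ for each $i\in\mathcal{I}$. A channel is a simple node with out-degree exactly one and without a self-loop. -}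

module Defs where

open import Data.Nat using (ℕ; zero; suc)
open import Data.Fin using (Fin)
open import Data.Bool using (Bool; true; false; _∧_; not; if_then_else_; T)
open import Data.List using (List; foldr; map; filter; length)
open import Data.List.Base using (allFin)
open import Data.Product using (Σ; _×_; ∃)
open import Data.Sum using (_⊎_)
open import Relation.Binary.PropositionalEquality using (_≡_)
open import Relation.Nullary using (¬_)
open import Relation.Nullary.Decidable using (T?)

-- A CBCN with n state variables:
--   ctrl i = true  iff  i ∈ 𝓘 (directly controlled)
--   ε j i  = ε_{ji}
record CBCN (n : ℕ) : Set where
  field
    ctrl : Fin n → Bool
    ε    : Fin n → Fin n → Bool
open CBCN public

State : ℕ → Set
State n = Fin n → Bool

-- control vector at one time step (entries for i ∉ 𝓘 are ignored)
Input : ℕ → Set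
Input n = Fin n → Bool

pow : Bool → Bool → Bool
pow x true  = x
pow x false = true

andAll : ∀ {n} → (Fin n → Bool) → Bool
andAll {n} f = foldr _∧_ true (map f (allFin n))

step : ∀ {n} → CBCN n → State n → Input n → State n
step B x u i = if ctrl B i then u i else andAll (λ j → pow (x j) (ε B j i))

run : ∀ {n} → CBCN n → State n → (ℕ → Input n) → ℕ → State n
run B a us zero    = a
run B a us (suc k) = step B (run B a us k) (us k) 

Controllable : ∀ {n} → CBCN n → Set
Controllable {n} B = (a b : State n) →
  Σ ℕ λ N → Σ (ℕ → Input n) λ us → run B a us N ≡ b

-- i ∉ 𝓘 has constant update function iff ε_{ji} = 0 for all j
ConstantUpdate : ∀ {n} → CBCN n → Fin n → Set
ConstantUpdate B i = T (not (ctrl B i)) × (∀ j → ε B j i ≡ false)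

NoConstantUpdate : ∀ {n} → CBCN n → Set
NoConstantUpdate {n} B = (i : Fin n) → ¬ ConstantUpdate B i

data Vertex {n : ℕ} (B : CBCN n) : Set where
  simple : Fin n → Vertex B
  gen    : (i : Fin n) → T (ctrl B i) → Vertex B

data Arc {n : ℕ} (B : CBCN n) : Vertex B → Vertex B → Set where
  simpleArc : ∀ j i → T (not (ctrl B i)) → T (ε B j i) → Arc B (simple j) (simple i)
  genArc    : ∀ i (c : T (ctrl B i)) → Arc B (gen i c) (simple i)

arcB : ∀ {n} → CBCN n → Fin n → Fin n → Bool
arcB B j i = not (ctrl B i) ∧ ε B j i

-- out-degree of simple node j (its out-neighbours are all simple nodes)
outDegree : ∀ {n} → CBCN n → Fin n → ℕ
outDegree {n} B j = length (filter (λ i → T? (arcB B j i)) (allFin n))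

Channel : ∀ {n} → CBCN n → Fin n → Set
Channel B j = outDegree B j ≡ 1 × ¬ Arc B (simple j) (simple j)

IsGenerator : ∀ {n} {B : CBCN n} → Vertex B → Set
IsGenerator (simple _) = Data.Empty.⊥
  where import Data.Empty
IsGenerator (gen _ _)  = Data.Unit.⊤
  where import Data.Unit

IsChannel : ∀ {n} {B : CBCN n} → Vertex B → Set
IsChannel {B = B} (simple j) = Channel B j
IsChannel (gen _ _) = Data.Empty.⊥
  where import Data.Empty

PropertyP : ∀ {n} → CBCN n → Set
PropertyP {n} B = (i : Fin n) →
  ∃ λ (v : Vertex B) → Arc B v (simple i) × (IsGenerator v ⊎ IsChannel v)

module Submission where

-- Let i be a state-variable.  If i is controlled, the generator U_i is an
-- in-neighbour of i.  Otherwise i is updated by x_i(k+1) = AND of x_j(k) over its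
-- in-neighbours j, and we show that the absence of a channel among them contradicts
-- controllability:
--   * if i has a self-loop, a 0 at i is trapped forever, so the all-ones state is not
--     reachable from the all-zeros state;
--   * if i has no self-loop, an in-neighbour j of i that is not a channel must also feed
--     some other node i' (out-degree 1 without self-loop would make j a channel).  If every
--     in-neighbour is of this kind, the state that is 0 exactly at i is unreachable from
--     all-ones: the 0 that enters i at the last step comes from some j, and it enters i'
--     at the same time.

open import Defs
open import Data.Nat using (ℕ; zero; suc)
open import Data.Fin using (Fin; _≟_)
open import Data.Fin.Properties using (any?)
open import Data.Bool using (Bool; true; false; not; T)
open import Data.Bool.Properties using (T-≡; T-not-≡; T-∧)
open import Data.Unit using (tt)
open import Data.Empty using (⊥-elim)
open import Data.List using (List; _∷_; [_]; filter; length; allFin)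
open import Data.List.Properties using (filter-accept; filter-reject; filter-none)
open import Data.List.Membership.Propositional using (_∈_)
open import Data.List.Membership.Propositional.Properties using (∈-allFin)
import Data.List.Relation.Unary.All as All
open import Data.List.Relation.Unary.All.Properties using (all⁺; all⁻; tabulate⁺; tabulate⁻)
open import Data.List.Relation.Unary.Any using (here; there)
open import Data.List.Relation.Unary.Unique.Propositional using (Unique)
open import Data.List.Relation.Unary.Unique.Propositional.Properties using (allFin⁺)
open import Data.List.Relation.Unary.AllPairs using (_∷_)
open import Data.Product using (∃; _×_; _,_; proj₁; proj₂)
open import Data.Sum using (_⊎_; inj₁; inj₂)
open import Function using (_∘_)
open import Function.Bundles using (_⇔_; mk⇔; Equivalence)
open import Relation.Binary.PropositionalEquality
  using (_≡_; _≢_; refl; sym; trans; cong; cong-app; subst)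
open import Relation.Nullary using (¬_; Dec; does; yes; no)
open import Relation.Nullary.Decidable
  using (T?; ¬?; _×-dec_; decidable-stable; dec-true; dec-false)
open import Relation.Unary using (Decidable)

open Equivalence using (to; from)

T-andAll : ∀ {n} (f : Fin n → Bool) → T (andAll f) ⇔ (∀ j → T (f j))
T-andAll {n} f =
  mk⇔ (λ t → tabulate⁻ (all⁺ f (allFin n) t)) (λ h → all⁻ f (tabulate⁺ h))

T-pow : ∀ x e → T (pow x e) ⇔ (T e → T x)
T-pow x true  = mk⇔ (λ t _ → t) (λ h → h tt)
T-pow x false = mk⇔ (λ _ ()) (λ _ → tt)

uncontrolled-update : ∀ {n} (B : CBCN n) (x : State n) (u : Input n) {i} →
  T (not (ctrl B i)) → T (step B x u i) ⇔ (∀ j → T (ε B j i) → T (x j))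
uncontrolled-update B x u {i} nc with ctrl B i
... | false = mk⇔
  (λ t j → to (T-pow _ _) (to (T-andAll _) t j))
  (λ h → from (T-andAll _) (λ j → from (T-pow _ _) (h j)))

self-loop-traps-zero : ∀ {n} (B : CBCN n) {i} → T (not (ctrl B i)) → T (ε B i i) →
  ∀ a us → ¬ T (a i) → ∀ k → ¬ T (run B a us k i)
self-loop-traps-zero B nc loop a us ¬ai zero = ¬ai
self-loop-traps-zero B {i} nc loop a us ¬ai (suc k) t =
  self-loop-traps-zero B nc loop a us ¬ai k
    (to (uncontrolled-update B (run B a us k) (us k) nc) t i loop)

self-loop-obstructs : ∀ {n} (B : CBCN n) {i} → T (not (ctrl B i)) → T (ε B i i) →
  ¬ Controllable B
self-loop-obstructs B {i} nc loop ctl with ctl (λ _ → false) (λ _ → true)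
... | N , us , reached =
  self-loop-traps-zero B nc loop _ us (λ ()) N (subst T (sym (cong-app reached i)) tt)

FeedsOtherThan : ∀ {n} → CBCN n → Fin n → Fin n → Set
FeedsOtherThan B j i = ∃ λ i' → i' ≢ i × T (arcB B j i')

feedsOtherThan? : ∀ {n} (B : CBCN n) j i → Dec (FeedsOtherThan B j i)
feedsOtherThan? B j i = any? (λ i' → ¬? (i' ≟ i) ×-dec T? (arcB B j i'))

zeroOnlyAt : ∀ {n} → Fin n → State n
zeroOnlyAt i k = not (does (k ≟ i))

zeroOnlyAt-here : ∀ {n} (i : Fin n) → ¬ T (zeroOnlyAt i i)
zeroOnlyAt-here i rewrite dec-true (i ≟ i) refl = λ ()

zeroOnlyAt-elsewhere : ∀ {n} {i k : Fin n} → k ≢ i → T (zeroOnlyAt i k)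
zeroOnlyAt-elsewhere {i = i} {k} k≢i rewrite dec-false (k ≟ i) k≢i = tt

-- Second obstruction: if every in-neighbour of the uncontrolled variable i also feeds
-- another node, then zeroOnlyAt i is unreachable from all-ones, since any 0 entering i
-- enters that other node simultaneously.
shared-in-neighbours-obstruct : ∀ {n} (B : CBCN n) {i} → T (not (ctrl B i)) →
  (∀ j → T (arcB B j i) → FeedsOtherThan B j i) → ¬ Controllable B
shared-in-neighbours-obstruct {n} B {i} nc shared ctl with ctl (λ _ → true) (zeroOnlyAt i)
... | zero , _ , reached = zeroOnlyAt-here i (subst T (cong-app reached i) tt)
... | suc m , us , reached =
  zeroOnlyAt-here i (subst T (cong-app reached i) (from (uncontrolled-update B x u nc) inputsOne))
  where
    x : State n
    x = run B (λ _ → true) us m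
    u : Input n
    u = us m
    -- every in-neighbour j of i is 1 at time m, because the node i' it also feeds is 1 at m+1
    inputsOne : ∀ j → T (ε B j i) → T (x j)
    inputsOne j e with shared j (from T-∧ (nc , e))
    ... | i' , i'≢i , arc with to T-∧ arc
    ...   | nc' , e' =
      to (uncontrolled-update B x u nc')
        (subst T (sym (cong-app reached i')) (zeroOnlyAt-elsewhere i'≢i)) j e'

filter-singleton : ∀ {A : Set} {P : A → Set} (P? : Decidable P) {i : A} {xs : List A} →
  Unique xs → i ∈ xs → P i → (∀ y → P y → y ≡ i) → filter P? xs ≡ [ i ]
filter-singleton P? (i∉xs ∷ _) (here refl) Pi onlyI =
  trans (filter-accept P? Pi)
        (cong (_ ∷_) (filter-none P? (All.map (λ i≢y Py → i≢y (sym (onlyI _ Py))) i∉xs)))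
filter-singleton P? (x∉xs ∷ uniq) (there i∈xs) Pi onlyI =
  trans (filter-reject P? (λ Px → All.lookup x∉xs i∈xs (onlyI _ Px)))
        (filter-singleton P? uniq i∈xs Pi onlyI)

sole-out-neighbour-is-channel : ∀ {n} (B : CBCN n) {i j} → T (arcB B j i) →
  ¬ T (arcB B i i) → ¬ FeedsOtherThan B j i → Channel B j
sole-out-neighbour-is-channel {n} B {i} {j} arc noLoop lonely =
  cong length (filter-singleton (λ k → T? (arcB B j k)) (allFin⁺ n) (∈-allFin i) arc onlyI)
  , noSelfLoop
  where
    onlyI : ∀ k → T (arcB B j k) → k ≡ i
    onlyI k a = decidable-stable (k ≟ i) (λ k≢i → lonely (k , k≢i , a))
    noSelfLoop : ¬ Arc B (simple j) (simple j)
    noSelfLoop (simpleArc _ _ nc e) with onlyI j (from T-∧ (nc , e))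
    ... | refl = noLoop arc

channel-or-shared : ∀ {n} (B : CBCN n) {i} → ¬ T (arcB B i i) →
  (∃ λ j → T (arcB B j i) × Channel B j) ⊎ (∀ j → T (arcB B j i) → FeedsOtherThan B j i)
channel-or-shared B {i} noLoop
  with any? (λ j → T? (arcB B j i) ×-dec ¬? (feedsOtherThan? B j i))
... | yes (j , arc , lonely) = inj₁ (j , arc , sole-out-neighbour-is-channel B arc noLoop lonely)
... | no none = inj₂ λ j arc →
  decidable-stable (feedsOtherThan? B j i) (λ lonely → none (j , arc , lonely))

uncontrolled-has-channel-in-neighbour : ∀ {n} (B : CBCN n) {i} → T (not (ctrl B i)) →
  Controllable B → ∃ λ j → T (arcB B j i) × Channel B j
uncontrolled-has-channel-in-neighbour B {i} nc ctl with T? (ε B i i)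
... | yes loop = ⊥-elim (self-loop-obstructs B nc loop ctl)
... | no ¬loop with channel-or-shared B (¬loop ∘ proj₂ ∘ to T-∧)
...   | inj₁ channelIn = channelIn
...   | inj₂ shared = ⊥-elim (shared-in-neighbours-obstruct B nc shared ctl)

proposition2 : (n : ℕ) (B : CBCN n) → NoConstantUpdate B → Controllable B → PropertyP B
proposition2 n B _ ctl i with ctrl B i in controlled
... | true = gen i c , genArc i c , inj₁ tt
  where c = from T-≡ controlled
... | false with uncontrolled-has-channel-in-neighbour B (from T-not-≡ controlled) ctl
...   | j , arc , channel = simple j , simpleArc j i nc e , inj₂ channel
  where nc = proj₁ (to T-∧ arc)
        e = proj₂ (to T-∧ arc)
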